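{- Let $d\geq 7$ and let $G$ be a $d$-regular graph with girth $g(G)\geq 5$. Then for every vertex $x$ of $G$ there exists a proper $(d+1)$-coloring of $G$ in which $x$ and at least four of the neighbors of $x$ are b-vertices.
   Context: All graphs are simple, finite and undirected. The girth of $G$ is the length of a shortest cycle in $G$. A proper $k$-coloring of $G$ is a map $c:V(G)\to\{1,\dots,k\}$ with $c(u)\neq c(v)$ for every edge $uv$. Given such a coloring, a vertex $v$ is a b-vertex if every one of the $k$ colors appears on the closed neighborhood $N[v]=N(v)\cup\{v\}$. -}

module Defs where

open import Data.Nat using (ℕ; zero; suc; _+_; _≤_)
open import Data.Fin using (Fin; zero; suc; inject₁; fromℕ)
open import Data.Bool using (Bool; true; false)
open import Data.List using (length; filterᵇ; allFin)
open import Data.Product using (Σ; _×_; ∃)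
open import Data.Sum using (_⊎_)
open import Function.Definitions using (Injective)
open import Relation.Binary.PropositionalEquality using (_≡_; _≢_)

record Graph (n : ℕ) : Set where
  field
    adj    : Fin n → Fin n → Bool
    sym    : ∀ u v → adj u v ≡ adj v u
    irrefl : ∀ v → adj v v ≡ false

open Graph public

_∼[_]_ : {n : ℕ} → Fin n → Graph n → Fin n → Set
u ∼[ G ] v = adj G u v ≡ true

degree : {n : ℕ} → Graph n → Fin n → ℕ
degree {n} G v = length (filterᵇ (adj G v) (allFin n))

Regular : {n : ℕ} → ℕ → Graph n → Set
Regular d G = ∀ v → degree G v ≡ d

-- G contains a cycle of length k + 3: distinct vertices f 0, …, f (k+2)
-- with f i ∼ f (i+1) for all i and f (k+2) ∼ f 0.
HasCycle : {n : ℕ} → Graph n → ℕ → Set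
HasCycle {n} G k =
  Σ (Fin (suc (suc (suc k))) → Fin n) λ f →
    Injective _≡_ _≡_ f
    × (∀ (i : Fin (suc (suc k))) → f (inject₁ i) ∼[ G ] f (suc i))
    × (f (fromℕ (suc (suc k))) ∼[ G ] f zero)

GirthAtLeast : {n : ℕ} → ℕ → Graph n → Set
GirthAtLeast m G = ∀ k → HasCycle G k → m ≤ k + 3

Proper : {n k : ℕ} → Graph n → (Fin n → Fin k) → Set
Proper G c = ∀ u v → u ∼[ G ] v → c u ≢ c v

IsBVertex : {n k : ℕ} → Graph n → (Fin n → Fin k) → Fin n → Set
IsBVertex G c v = ∀ j → (c v ≡ j) ⊎ (∃ λ u → v ∼[ G ] u × c u ≡ j)

module Submission where

-- Colour x with 0 and its neighbours y u with u + 1.  For a neighbour y i to be a b-vertex,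
-- its other d - 1 neighbours z i t must receive, bijectively, the d - 1 colours different
-- from 0 and i + 1; such an assignment is a permutation σ i of Fin (d - 1).  Girth ≥ 5 makes
-- every vertex of a group z i adjacent to nothing in the first two layers except y i, and to at
-- most one vertex of each other group.  Hence, once the permutations of k earlier groups are
-- fixed, the forbidden (position, colour) pairs of the next group form k partial matchings,
-- and a permutation avoiding them exists when 2k ≤ d - 1: a bad position is swapped with one
-- outside a set of at most 2k - 1 excluded positions.  With four groups and d ≥ 7 this works,
-- and the colouring of the ball of radius two is completed greedily with d + 1 colours.

open import Defs renaming (sym to adj-sym; irrefl to adj-irrefl)

open import Data.Bool using (true)
import Data.Bool as Bool
open import Data.Bool.Properties using (T-≡)
open import Data.Empty using (⊥; ⊥-elim)
open import Data.Fin using (Fin; zero; suc; toℕ; fromℕ<; cast; inject₁; inject≤; punchIn; punchOut; splitAt; _↑ˡ_; _↑ʳ_)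
open import Data.Fin.Permutation using (Permutation′; _⟨$⟩ʳ_; _⟨$⟩ˡ_; inverseʳ; id; transpose; _∘ₚ_)
open import Data.Fin.Properties using (_≟_; any?; all?; toℕ<n; toℕ-injective; toℕ-fromℕ<; cast-involutive; inject≤-injective; injective⇒≤; splitAt-↑ˡ; splitAt-↑ʳ; punchIn-punchOut; punchInᵢ≢i; punchIn-injective; suc-injective)
open import Data.List as List using (List; _∷_; filterᵇ; allFin)
import Data.List.Relation.Unary.All as All
open import Data.List.Relation.Unary.AllPairs using (_∷_)
import Data.List.Relation.Unary.Any as Any
open import Data.List.Relation.Unary.Any.Properties using (lookup-index)
open import Data.List.Relation.Unary.Unique.Propositional using (Unique)
open import Data.List.Relation.Unary.Unique.Propositional.Properties using (filter⁺; allFin⁺)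
open import Data.List.Membership.Propositional using (_∈_)
open import Data.List.Membership.Propositional.Properties using (∈-lookup; ∈-filter⁺; ∈-filter⁻; ∈-allFin)
open import Data.Nat using (ℕ; zero; suc; _+_; _≤_; _<_; s≤s; z≤n)
open import Data.Nat.Properties using (≤-reflexive; <-irrefl; <⇒≱; <⇒≤; ≤-refl; ≤-trans; m≤n⇒m<n∨m≡n; +-suc; +-mono-≤; n≤1+n)
open import Data.Product using (Σ; _×_; _,_; proj₁; proj₂; ∃)
open import Data.Sum using (_⊎_; inj₁; inj₂; [_,_]′)
open import Data.Vec as Vec using (Vec; []; _∷_)
open import Data.Vec.Relation.Unary.All using ([]; _∷_)
open import Data.Vec.Relation.Unary.AllPairs using ([]; _∷_)
import Data.Vec.Relation.Unary.Unique.Propositional.Properties as Vecᵘ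
import Data.Vec.Functional as Vector
open import Data.Vec.Functional using (updateAt)
open import Data.Vec.Functional.Properties using (updateAt-updates; updateAt-minimal)
open import Function using (_∘_; const)
open import Function.Bundles using (Equivalence; Injection)
open import Function.Definitions using (Injective)
open import Function.Properties.Inverse using (↔⇒↣)
open import Level using (0ℓ)
open import Relation.Binary.PropositionalEquality using (_≡_; _≢_; refl; sym; trans; cong; subst; ≢-sym; module ≡-Reasoning)
open import Relation.Nullary using (¬_; Dec; yes; no; ¬?; _×-dec_)
open import Relation.Nullary.Decidable using (T?; map′)
open import Relation.Nullary.Negation using (contradiction)
open import Relation.Unary using (Pred; Decidable; _⊆_)

open ≡-Reasoning

missedValue : ∀ {l m} → l < m → (f : Fin l → Fin m) → ∃ λ a → ∀ i → f i ≢ a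
missedValue l<m f with any? (λ a → all? (λ i → ¬? (f i ≟ a)))
... | yes missed = missed
... | no none = contradiction (injective⇒≤ preimage-injective) (<⇒≱ l<m)
  where
  preimage : ∀ a → ∃ λ i → f i ≡ a
  preimage a with any? (λ i → f i ≟ a)
  ... | yes hit = hit
  ... | no ¬hit = contradiction (a , λ i eq → ¬hit (i , eq)) none
  preimage-injective : Injective _≡_ _≡_ (proj₁ ∘ preimage)
  preimage-injective {a} {b} eq =
    trans (sym (proj₂ (preimage a))) (trans (cong f eq) (proj₂ (preimage b)))

missedByBoth : ∀ {k m} → k + k ≤ m → (j₀ : Fin k) (f g : Fin k → Fin m) →
  ∃ λ a → (∀ j → f j ≢ a) × (∀ j → j ≢ j₀ → g j ≢ a)
missedByBoth {suc k} {m} 2k≤m j₀ f g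
  with missedValue (subst (_≤ m) (cong suc (+-suc k k)) 2k≤m) ([ f , g ∘ punchIn j₀ ]′ ∘ splitAt (suc k))
... | a , missed = a , missed-f , missed-g
  where
  missed-f : ∀ j → f j ≢ a
  missed-f j = subst (_≢ a) (cong [ f , g ∘ punchIn j₀ ]′ (splitAt-↑ˡ (suc k) j k)) (missed (j ↑ˡ k))
  missed-g : ∀ j → j ≢ j₀ → g j ≢ a
  missed-g j j≢j₀ = subst (_≢ a) g-at-i (missed (suc k ↑ʳ i))
    where
    i : Fin k
    i = punchOut (j≢j₀ ∘ sym)
    g-at-i : [ f , g ∘ punchIn j₀ ]′ (splitAt (suc k) (suc k ↑ʳ i)) ≡ g j
    g-at-i = trans (cong [ f , g ∘ punchIn j₀ ]′ (splitAt-↑ʳ (suc k) k i)) (cong g (punchIn-punchOut (j≢j₀ ∘ sym)))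

toℕ<suc⇒<∨≡fromℕ< : ∀ {q m} {t : Fin m} (q<m : q < m) → toℕ t < suc q → toℕ t < q ⊎ t ≡ fromℕ< q<m
toℕ<suc⇒<∨≡fromℕ< q<m (s≤s t≤q) with m≤n⇒m<n∨m≡n t≤q
... | inj₁ t<q = inj₁ t<q
... | inj₂ t≡q = inj₂ (toℕ-injective (trans t≡q (sym (toℕ-fromℕ< q<m))))

atMostOne⇒single : ∀ {m} {P : Pred (Fin m) 0ℓ} → Decidable P →
  (∀ {t t′} → P t → P t′ → t ≡ t′) → Fin m → ∃ λ r → ∀ t → P t → t ≡ r
atMostOne⇒single P? unique default with any? P?
... | yes (r , Pr) = r , λ t Pt → unique Pt Pr
... | no none = default , λ t Pt → contradiction (t , Pt) none

permutation-injective : ∀ {m} (π : Permutation′ m) → Injective _≡_ _≡_ (π ⟨$⟩ʳ_)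
permutation-injective π = Injection.injective (↔⇒↣ π)

lookup-injective : ∀ {A : Set} {xs : List A} → Unique xs → Injective _≡_ _≡_ (List.lookup xs)
lookup-injective {xs = _ ∷ _} _ {zero} {zero} _ = refl
lookup-injective {xs = _ ∷ xs} (x∉xs ∷ _) {zero} {suc j} eq = contradiction eq (All.lookup x∉xs (∈-lookup {xs = xs} j))
lookup-injective {xs = _ ∷ xs} (x∉xs ∷ _) {suc i} {zero} eq = contradiction (sym eq) (All.lookup x∉xs (∈-lookup {xs = xs} i))
lookup-injective {xs = _ ∷ _} (_ ∷ unique) {suc i} {suc j} eq = cong suc (lookup-injective unique eq)

module _ {A B : Set} {n : ℕ} {f : A → Fin n} (f-injective : Injective _≡_ _≡_ f)
         (f⁻¹? : ∀ w → Dec (∃ λ a → f a ≡ w)) (h : A → B) (h₀ : Fin n → B) where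

  extendAlong : Fin n → B
  extendAlong w with f⁻¹? w
  ... | yes (a , _) = h a
  ... | no _ = h₀ w

  extendAlong-image : ∀ a → extendAlong (f a) ≡ h a
  extendAlong-image a with f⁻¹? (f a)
  ... | yes (a′ , eq) = cong h (f-injective eq)
  ... | no none = contradiction (a , refl) none

  extendAlong-outside : ∀ w → (∀ a → f a ≢ w) → extendAlong w ≡ h₀ w
  extendAlong-outside w outside with f⁻¹? w
  ... | yes (a , eq) = contradiction eq (outside a)
  ... | no _ = refl

module _ {k m : ℕ} (M : Fin k → Fin m → Fin m → Set)
         (M? : ∀ j t a → Dec (M j t a))
         (M-functional : ∀ {j t a a′} → M j t a → M j t a′ → a ≡ a′)
         (M-injective : ∀ {j t t′ a} → M j t a → M j t′ a → t ≡ t′) where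

  Admissible : Fin m → Fin m → Set
  Admissible t a = ∀ j → ¬ M j t a

  rowClash : (π : Permutation′ m) (t₀ : Fin m) (j : Fin k) → ∃ λ r → ∀ t → M j t₀ (π ⟨$⟩ʳ t) → t ≡ r
  rowClash π t₀ j = atMostOne⇒single (λ t → M? j t₀ (π ⟨$⟩ʳ t))
    (λ Mt Mt′ → permutation-injective π (M-functional Mt Mt′)) t₀

  columnClash : (π : Permutation′ m) (t₀ : Fin m) (j : Fin k) → ∃ λ r → ∀ t → M j t (π ⟨$⟩ʳ t₀) → t ≡ r
  columnClash π t₀ j = atMostOne⇒single (λ t → M? j t (π ⟨$⟩ʳ t₀)) M-injective t₀

  repairRow : k + k ≤ m → (π : Permutation′ m) (t₀ : Fin m) →
    ∃ λ t₁ → Admissible t₀ (π ⟨$⟩ʳ t₁) × Admissible t₁ (π ⟨$⟩ʳ t₀)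
  repairRow 2k≤m π t₀ with any? (λ j → M? j t₀ (π ⟨$⟩ʳ t₀))
  ... | no fine = t₀ , admissible , admissible
    where
    admissible : Admissible t₀ (π ⟨$⟩ʳ t₀)
    admissible j Mj = fine (j , Mj)
  ... | yes (j₀ , M₀) with missedByBoth 2k≤m j₀ (proj₁ ∘ rowClash π t₀) (proj₁ ∘ columnClash π t₀)
  ...   | t₁ , ∉row , ∉column = t₁ , admissible₀ , admissible₁
    where
    admissible₀ : Admissible t₀ (π ⟨$⟩ʳ t₁)
    admissible₀ j Mj = ∉row j (sym (proj₂ (rowClash π t₀ j) t₁ Mj))
    admissible₁ : Admissible t₁ (π ⟨$⟩ʳ t₀)
    admissible₁ j Mj with j ≟ j₀
    ... | yes refl = ∉row j₀ (sym (trans (M-injective Mj M₀) (proj₂ (rowClash π t₀ j₀) t₀ M₀)))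
    ... | no j≢j₀ = ∉column j j≢j₀ (sym (proj₂ (columnClash π t₀ j) t₁ Mj))

  swap-admissible : ∀ (π : Permutation′ m) {t₀ t₁} →
    Admissible t₀ (π ⟨$⟩ʳ t₁) → Admissible t₁ (π ⟨$⟩ʳ t₀) →
    ∀ t → (t ≢ t₀ → t ≢ t₁ → Admissible t (π ⟨$⟩ʳ t)) → Admissible t ((transpose t₀ t₁ ∘ₚ π) ⟨$⟩ʳ t)
  swap-admissible π {t₀} {t₁} ok₀ ok₁ t ok with t ≟ t₀
  ... | yes refl = ok₀
  ... | no t≢t₀ with t ≟ t₁
  ...   | yes refl = ok₁
  ...   | no t≢t₁ = ok t≢t₀ t≢t₁

  admissiblePrefix : k + k ≤ m → ∀ q → q ≤ m →
    ∃ λ (π : Permutation′ m) → ∀ t → toℕ t < q → Admissible t (π ⟨$⟩ʳ t)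
  admissiblePrefix _ zero _ = id , λ _ ()
  admissiblePrefix 2k≤m (suc q) q<m with admissiblePrefix 2k≤m q (<⇒≤ q<m)
  ... | π , admissible with repairRow 2k≤m π (fromℕ< q<m)
  ...   | t₁ , ok₀ , ok₁ = transpose (fromℕ< q<m) t₁ ∘ₚ π ,
                           λ t t≤q → swap-admissible π ok₀ ok₁ t λ t≢q _ → earlier t t≤q t≢q
    where
    earlier : ∀ t → toℕ t < suc q → t ≢ fromℕ< q<m → Admissible t (π ⟨$⟩ʳ t)
    earlier t t≤q t≢q with toℕ<suc⇒<∨≡fromℕ< q<m t≤q
    ... | inj₁ t<q = admissible t t<q
    ... | inj₂ t≡q = contradiction t≡q t≢q

  admissiblePermutation : k + k ≤ m → ∃ λ (π : Permutation′ m) → ∀ t → Admissible t (π ⟨$⟩ʳ t)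
  admissiblePermutation 2k≤m with admissiblePrefix 2k≤m m ≤-refl
  ... | π , admissible = π , λ t → admissible t (toℕ<n t)

module GraphProperties {n : ℕ} (G : Graph n) where

  infix 4 _∼_
  _∼_ : Fin n → Fin n → Set
  u ∼ v = u ∼[ G ] v

  ∼-sym : ∀ {u v} → u ∼ v → v ∼ u
  ∼-sym {u} {v} u∼v = trans (adj-sym G v u) u∼v

  ∼⇒≢ : ∀ {u v} → u ∼ v → u ≢ v
  ∼⇒≢ {u} u∼u refl with trans (sym u∼u) (adj-irrefl G u)
  ... | ()

  _∼?_ : ∀ u v → Dec (u ∼ v)
  u ∼? v = adj G u v Bool.≟ true

  module Neighbours (v : Fin n) {d : ℕ} (deg : degree G v ≡ d) where

    private
      neighbours : List (Fin n)
      neighbours = filterᵇ (adj G v) (allFin n)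

    neighbour : Fin d → Fin n
    neighbour i = List.lookup neighbours (cast (sym deg) i)

    neighbour-adj : ∀ i → v ∼ neighbour i
    neighbour-adj i = Equivalence.to T-≡
      (proj₂ (∈-filter⁻ (T? ∘ adj G v) {xs = allFin n} (∈-lookup {xs = neighbours} _)))

    neighbour-injective : Injective _≡_ _≡_ neighbour
    neighbour-injective {i} {j} eq = begin
      i                             ≡⟨ cast-involutive deg (sym deg) i ⟨
      cast deg (cast (sym deg) i)   ≡⟨ cong (cast deg) (lookup-injective (filter⁺ (T? ∘ adj G v) (allFin⁺ n)) eq) ⟩
      cast deg (cast (sym deg) j)   ≡⟨ cast-involutive deg (sym deg) j ⟩
      j                             ∎

    neighbour-surjective : ∀ {w} → v ∼ w → ∃ λ i → neighbour i ≡ w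
    neighbour-surjective {w} v∼w = cast deg (Any.index w∈) , (begin
      List.lookup neighbours (cast (sym deg) (cast deg (Any.index w∈)))
        ≡⟨ cong (List.lookup neighbours) (cast-involutive (sym deg) deg _) ⟩
      List.lookup neighbours (Any.index w∈)
        ≡⟨ lookup-index w∈ ⟨
      w ∎)
      where
      w∈ : w ∈ neighbours
      w∈ = ∈-filter⁺ (T? ∘ adj G v) (∈-allFin w) (Equivalence.from T-≡ v∼w)

  module OtherNeighbours (v w : Fin n) (v∼w : v ∼ w) {d : ℕ} (deg : degree G v ≡ suc d) where

    open Neighbours v deg

    private
      position : ∃ λ r → neighbour r ≡ w
      position = neighbour-surjective v∼w

    otherNeighbour : Fin d → Fin n
    otherNeighbour i = neighbour (punchIn (proj₁ position) i)

    otherNeighbour-adj : ∀ i → v ∼ otherNeighbour i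
    otherNeighbour-adj i = neighbour-adj _

    otherNeighbour≢ : ∀ i → otherNeighbour i ≢ w
    otherNeighbour≢ i eq = punchInᵢ≢i (proj₁ position) i (neighbour-injective (trans eq (sym (proj₂ position))))

    otherNeighbour-injective : Injective _≡_ _≡_ otherNeighbour
    otherNeighbour-injective eq = punchIn-injective (proj₁ position) _ _ (neighbour-injective eq)

  module _ (girth : GirthAtLeast 5 G) where

    noTriangle : ∀ {a b c} → a ∼ b → b ∼ c → c ∼ a → ⊥
    noTriangle {a} {b} {c} a∼b b∼c c∼a = 5≰3 (girth 0 (Vec.lookup cycle , injective , edges , c∼a))
      where
      cycle : Vec (Fin n) 3
      cycle = a ∷ b ∷ c ∷ []
      injective : Injective _≡_ _≡_ (Vec.lookup cycle)
      injective = Vecᵘ.lookup-injective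
        ((∼⇒≢ a∼b ∷ ≢-sym (∼⇒≢ c∼a) ∷ []) ∷ (∼⇒≢ b∼c ∷ []) ∷ [] ∷ []) _ _
      edges : ∀ i → Vec.lookup cycle (inject₁ i) ∼ Vec.lookup cycle (suc i)
      edges zero = a∼b
      edges (suc zero) = b∼c
      5≰3 : ¬ 5 ≤ 3
      5≰3 (s≤s (s≤s (s≤s ())))

    noQuadrilateral : ∀ {a b c e} → a ∼ b → b ∼ c → c ∼ e → e ∼ a → a ≢ c → b ≢ e → ⊥
    noQuadrilateral {a} {b} {c} {e} a∼b b∼c c∼e e∼a a≢c b≢e =
      5≰4 (girth 1 (Vec.lookup cycle , injective , edges , e∼a))
      where
      cycle : Vec (Fin n) 4
      cycle = a ∷ b ∷ c ∷ e ∷ []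
      injective : Injective _≡_ _≡_ (Vec.lookup cycle)
      injective = Vecᵘ.lookup-injective
        ((∼⇒≢ a∼b ∷ a≢c ∷ ≢-sym (∼⇒≢ e∼a) ∷ []) ∷ (∼⇒≢ b∼c ∷ b≢e ∷ []) ∷ (∼⇒≢ c∼e ∷ []) ∷ [] ∷ []) _ _
      edges : ∀ i → Vec.lookup cycle (inject₁ i) ∼ Vec.lookup cycle (suc i)
      edges zero = a∼b
      edges (suc zero) = b∼c
      edges (suc (suc zero)) = c∼e
      5≰4 : ¬ 5 ≤ 4
      5≰4 (s≤s (s≤s (s≤s (s≤s ()))))

    commonNeighbour-unique : ∀ {a b c e} → a ∼ b → a ∼ e → c ∼ b → c ∼ e → a ≢ c → b ≡ e
    commonNeighbour-unique {b = b} {e = e} a∼b a∼e c∼b c∼e a≢c with b ≟ e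
    ... | yes b≡e = b≡e
    ... | no b≢e = ⊥-elim (noQuadrilateral a∼b (∼-sym c∼b) c∼e (∼-sym a∼e) a≢c b≢e)

  ProperOn : ∀ {k} → Pred (Fin n) 0ℓ → (Fin n → Fin k) → Set
  ProperOn S c = ∀ u v → S u → S v → u ∼ v → c u ≢ c v

  ProperOn-mono : ∀ {k} {S T : Pred (Fin n) 0ℓ} {c : Fin n → Fin k} → S ⊆ T → ProperOn T c → ProperOn S c
  ProperOn-mono S⊆T proper u v Su Sv = proper u v (S⊆T Su) (S⊆T Sv)

  ProperOn-updateAt : ∀ {k} {S : Pred (Fin n) 0ℓ} {c : Fin n → Fin k} {v a} → ¬ S v → ProperOn S c →
    (∀ w → v ∼ w → c w ≢ a) → ProperOn (λ w → S w ⊎ w ≡ v) (updateAt c v (const a))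
  ProperOn-updateAt {S = S} {c} {v} {a} ¬Sv proper free = proper′
    where
    kept : ∀ {u} → S u → updateAt c v (const a) u ≡ c u
    kept {u} Su = updateAt-minimal u v c λ { refl → ¬Sv Su }
    proper′ : ProperOn (λ w → S w ⊎ w ≡ v) (updateAt c v (const a))
    proper′ u u′ (inj₁ Su) (inj₁ Su′) u∼u′ eq =
      proper u u′ Su Su′ u∼u′ (trans (sym (kept Su)) (trans eq (kept Su′)))
    proper′ _ u′ (inj₂ refl) (inj₁ Su′) v∼u′ eq =
      free u′ v∼u′ (sym (trans (sym (updateAt-updates v c)) (trans eq (kept Su′))))
    proper′ u _ (inj₁ Su) (inj₂ refl) u∼v eq =
      free u (∼-sym u∼v) (trans (sym (kept Su)) (trans eq (updateAt-updates v c)))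
    proper′ _ _ (inj₂ refl) (inj₂ refl) v∼v _ = ∼⇒≢ v∼v refl

  freeColour : ∀ {d} (c : Fin n → Fin (suc d)) v → degree G v ≤ d → ∃ λ a → ∀ w → v ∼ w → c w ≢ a
  freeColour c v deg≤d with missedValue (s≤s deg≤d) (c ∘ Neighbours.neighbour v refl)
  ... | a , missed = a , λ w v∼w →
    subst (λ u → c u ≢ a) (proj₂ (Neighbours.neighbour-surjective v refl v∼w)) (missed _)

  extendColouring : ∀ {d} → (∀ v → degree G v ≤ d) → {S : Pred (Fin n) 0ℓ} → Decidable S →
    (c : Fin n → Fin (suc d)) → ProperOn S c → ∃ λ c′ → Proper G c′ × (∀ v → S v → c′ v ≡ c v)
  extendColouring {d} Δ≤d {S} S? c proper =
    let c′ , proper′ , agree = prefix n ≤-refl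
    in c′ , (λ u v → proper′ u v (inj₂ (toℕ<n u)) (inj₂ (toℕ<n v))) , agree
    where
    Done : ℕ → Pred (Fin n) 0ℓ
    Done q w = S w ⊎ toℕ w < q
    prefix : ∀ q → q ≤ n → ∃ λ c′ → ProperOn (Done q) c′ × (∀ v → S v → c′ v ≡ c v)
    prefix zero _ = c , ProperOn-mono (λ { (inj₁ Sw) → Sw }) proper , λ _ _ → refl
    prefix (suc q) q<n with prefix q (<⇒≤ q<n) | S? (fromℕ< q<n)
    ... | c′ , proper′ , agree | yes Sq = c′ , ProperOn-mono done proper′ , agree
      where
      done : Done (suc q) ⊆ Done q
      done (inj₁ Sw) = inj₁ Sw
      done (inj₂ w≤q) with toℕ<suc⇒<∨≡fromℕ< q<n w≤q
      ... | inj₁ w<q = inj₂ w<q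
      ... | inj₂ refl = inj₁ Sq
    ... | c′ , proper′ , agree | no ¬Sq with freeColour c′ (fromℕ< q<n) (Δ≤d _)
    ...   | a , free =
      updateAt c′ (fromℕ< q<n) (const a) , ProperOn-mono done (ProperOn-updateAt ¬Done proper′ free) , agree′
      where
      ¬Done : ¬ Done q (fromℕ< q<n)
      ¬Done (inj₁ Sq) = ¬Sq Sq
      ¬Done (inj₂ q<q) = <-irrefl (toℕ-fromℕ< q<n) q<q
      done : Done (suc q) ⊆ (λ w → Done q w ⊎ w ≡ fromℕ< q<n)
      done (inj₁ Sw) = inj₁ (inj₁ Sw)
      done (inj₂ w≤q) with toℕ<suc⇒<∨≡fromℕ< q<n w≤q
      ... | inj₁ w<q = inj₁ (inj₂ w<q)
      ... | inj₂ w≡q = inj₂ w≡q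
      agree′ : ∀ w → S w → updateAt c′ (fromℕ< q<n) (const a) w ≡ c w
      agree′ w Sw = trans (updateAt-minimal w _ c′ λ { refl → ¬Sq Sw }) (agree w Sw)

module BVertexColouring {m n : ℕ} (G : Graph n) (regular : Regular (suc m) G)
                        (girth : GirthAtLeast 5 G) (x : Fin n) where

  open GraphProperties G
  open Neighbours x (regular x) public
    renaming (neighbour to y; neighbour-adj to y-adj; neighbour-injective to y-injective)

  module SecondNeighbours (i : Fin (suc m)) = OtherNeighbours (y i) x (∼-sym (y-adj i)) (regular (y i))
  open SecondNeighbours
    renaming (otherNeighbour to z; otherNeighbour-adj to z-adj; otherNeighbour≢ to z≢x;
              otherNeighbour-injective to z-injective)

  x≁z : ∀ i t → ¬ x ∼ z i t
  x≁z i t x∼z = noTriangle girth (y-adj i) (z-adj i t) (∼-sym x∼z)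

  y≢z : ∀ j i t → y j ≢ z i t
  y≢z j i t eq = x≁z i t (subst (x ∼_) eq (y-adj j))

  z-disjoint : ∀ {i j t t′} → z i t ≡ z j t′ → i ≡ j
  z-disjoint {i} {j} {t} {t′} eq = y-injective
    (commonNeighbour-unique girth (y-adj i) (y-adj j) (∼-sym (z-adj i t))
      (subst (_∼ y j) (sym eq) (∼-sym (z-adj j t′))) (≢-sym (z≢x i t)))

  palette : Fin (suc m) → Fin m → Fin (suc (suc m))
  palette i t = suc (punchIn i t)

  palette-injective : ∀ i → Injective _≡_ _≡_ (palette i)
  palette-injective i eq = punchIn-injective i _ _ (suc-injective eq)

  Compatible : Fin (suc m) → Fin (suc m) → Permutation′ m → Permutation′ m → Set
  Compatible i j σ τ = ∀ t t′ → z i t ∼ z j t′ → palette i (σ ⟨$⟩ʳ t) ≢ palette j (τ ⟨$⟩ʳ t′)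

  Compatible-sym : ∀ {i j σ τ} → Compatible i j σ τ → Compatible j i τ σ
  Compatible-sym compatible t t′ adj eq = compatible t′ t (∼-sym adj) (sym eq)

  compatiblePermutation : ∀ {k} → k + k ≤ m → ∀ i (e : Fin k → Fin (suc m)) (τ : Fin k → Permutation′ m) →
    ∃ λ σ → ∀ j → Compatible i (e j) σ (τ j)
  compatiblePermutation {k} 2k≤m i e τ =
    let σ , admissible = admissiblePermutation Clash Clash? Clash-functional Clash-injective 2k≤m
    in σ , λ j t t′ adj eq → admissible t j (t′ , adj , eq)
    where
    Clash : Fin k → Fin m → Fin m → Set
    Clash j t a = ∃ λ t′ → z i t ∼ z (e j) t′ × palette i a ≡ palette (e j) (τ j ⟨$⟩ʳ t′)
    Clash? : ∀ j t a → Dec (Clash j t a)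
    Clash? j t a = any? λ t′ → (z i t ∼? z (e j) t′) ×-dec (palette i a ≟ palette (e j) (τ j ⟨$⟩ʳ t′))
    Clash-functional : ∀ {j t a a′} → Clash j t a → Clash j t a′ → a ≡ a′
    Clash-functional {j} {t} (u , adj , eq) (u′ , adj′ , eq′)
      with z-injective (e j) (commonNeighbour-unique girth (z-adj (e j) u) (z-adj (e j) u′) adj adj′ (y≢z (e j) i t))
    ... | refl = palette-injective i (trans eq (sym eq′))
    Clash-injective : ∀ {j t t′ a} → Clash j t a → Clash j t′ a → t ≡ t′
    Clash-injective {j} {t} {t′} (u , adj , eq) (u′ , adj′ , eq′)
      with permutation-injective (τ j) (palette-injective (e j) (trans (sym eq) eq′))
    ... | refl = z-injective i
      (commonNeighbour-unique girth (∼-sym adj) (∼-sym adj′) (z-adj i t) (z-adj i t′) (≢-sym (y≢z i (e j) u)))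

  compatibleFamily : ∀ {s} → s + s ≤ m → (e : Fin (suc s) → Fin (suc m)) →
    ∃ λ (σ : Fin (suc s) → Permutation′ m) → ∀ a b → a ≢ b → Compatible (e a) (e b) (σ a) (σ b)
  compatibleFamily {zero} _ e = (λ _ → id) , λ { zero zero 0≢0 → contradiction refl 0≢0 }
  compatibleFamily {suc s} 2s≤m e =
    let τ , τ-compatible = compatibleFamily (≤-trans (+-mono-≤ (n≤1+n s) (n≤1+n s)) 2s≤m) (e ∘ suc)
        σ₀ , σ₀-compatible = compatiblePermutation 2s≤m (e zero) (e ∘ suc) τ
        compatible : ∀ a b → a ≢ b → Compatible (e a) (e b) ((σ₀ Vector.∷ τ) a) ((σ₀ Vector.∷ τ) b)
        compatible = λ where
          zero zero 0≢0 → contradiction refl 0≢0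
          zero (suc b) _ → σ₀-compatible b
          (suc a) zero _ → Compatible-sym {e zero} {e (suc a)} {σ₀} {τ a} (σ₀-compatible a)
          (suc a) (suc b) a≢b → τ-compatible a b (a≢b ∘ cong suc)
    in σ₀ Vector.∷ τ , compatible

  module BallColouring {s : ℕ} (e : Fin (suc s) → Fin (suc m)) (e-injective : Injective _≡_ _≡_ e)
                       (σ : Fin (suc s) → Permutation′ m)
                       (compatible : ∀ a b → a ≢ b → Compatible (e a) (e b) (σ a) (σ b)) where

    data Ball : Pred (Fin n) 0ℓ where
      centre : Ball x
      inner  : ∀ u → Ball (y u)
      outer  : ∀ a t → Ball (z (e a) t)

    outerVertex : Fin (suc s) × Fin m → Fin n
    outerVertex (a , t) = z (e a) t

    outerVertex-injective : Injective _≡_ _≡_ outerVertex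
    outerVertex-injective {a , t} {b , t′} eq with e-injective (z-disjoint eq)
    ... | refl = cong (a ,_) (z-injective (e a) eq)

    y⁻¹? : ∀ w → Dec (∃ λ u → y u ≡ w)
    y⁻¹? w = any? λ u → y u ≟ w

    outerVertex⁻¹? : ∀ w → Dec (∃ λ p → outerVertex p ≡ w)
    outerVertex⁻¹? w = map′ (λ (a , t , eq) → (a , t) , eq) (λ ((a , t) , eq) → a , t , eq)
      (any? λ a → any? λ t → z (e a) t ≟ w)

    colour : Fin n → Fin (suc (suc m))
    colour = extendAlong y-injective y⁻¹? suc
      (extendAlong outerVertex-injective outerVertex⁻¹? (λ (a , t) → palette (e a) (σ a ⟨$⟩ʳ t)) (const zero))

    colour-x : colour x ≡ zero
    colour-x = trans (extendAlong-outside y-injective y⁻¹? suc _ x (λ u → ∼⇒≢ (y-adj u) ∘ sym))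
                     (extendAlong-outside outerVertex-injective outerVertex⁻¹? _ _ x (λ (a , t) → z≢x (e a) t))

    colour-y : ∀ u → colour (y u) ≡ suc u
    colour-y = extendAlong-image y-injective y⁻¹? suc _

    colour-z : ∀ a t → colour (z (e a) t) ≡ palette (e a) (σ a ⟨$⟩ʳ t)
    colour-z a t = trans (extendAlong-outside y-injective y⁻¹? suc _ _ (λ u → y≢z u (e a) t))
                         (extendAlong-image outerVertex-injective outerVertex⁻¹? _ _ (a , t))

    ball? : Decidable Ball
    ball? w with w ≟ x | y⁻¹? w | outerVertex⁻¹? w
    ... | yes refl | _ | _ = yes centre
    ... | no _ | yes (u , refl) | _ = yes (inner u)
    ... | no _ | no _ | yes ((a , t) , refl) = yes (outer a t)
    ... | no w≢x | no w∉y | no w∉z = no λ where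
      centre → w≢x refl
      (inner u) → w∉y (u , refl)
      (outer a t) → w∉z ((a , t) , refl)

    x-y-colour : ∀ u → colour x ≢ colour (y u)
    x-y-colour u eq with trans (sym colour-x) (trans eq (colour-y u))
    ... | ()

    y-z-colour : ∀ u a t → y u ∼ z (e a) t → colour (y u) ≢ colour (z (e a) t)
    y-z-colour u a t y∼z eq = z≢x (e a) t (sym (commonNeighbour-unique girth
      (∼-sym (y-adj u)) y∼z (∼-sym (y-adj (e a))) (z-adj (e a) t) (u≢ea ∘ y-injective)))
      where
      u≡ : u ≡ punchIn (e a) (σ a ⟨$⟩ʳ t)
      u≡ = suc-injective (trans (sym (colour-y u)) (trans eq (colour-z a t)))
      u≢ea : u ≢ e a
      u≢ea u≡ea = punchInᵢ≢i (e a) _ (trans (sym u≡) u≡ea)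

    z-z-colour : ∀ a t b t′ → z (e a) t ∼ z (e b) t′ → colour (z (e a) t) ≢ colour (z (e b) t′)
    z-z-colour a t b t′ z∼z eq with a ≟ b
    ... | yes refl = noTriangle girth (z-adj (e a) t) z∼z (∼-sym (z-adj (e a) t′))
    ... | no a≢b = compatible a b a≢b t t′ z∼z (trans (sym (colour-z a t)) (trans eq (colour-z b t′)))

    colour-proper : ProperOn Ball colour
    colour-proper _ _ centre centre x∼x = contradiction refl (∼⇒≢ x∼x)
    colour-proper _ _ centre (inner u) _ = x-y-colour u
    colour-proper _ _ centre (outer a t) x∼z = contradiction x∼z (x≁z (e a) t)
    colour-proper _ _ (inner u) centre _ = x-y-colour u ∘ sym
    colour-proper _ _ (inner u) (inner u′) y∼y = ⊥-elim (noTriangle girth (y-adj u) y∼y (∼-sym (y-adj u′)))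
    colour-proper _ _ (inner u) (outer a t) y∼z = y-z-colour u a t y∼z
    colour-proper _ _ (outer a t) centre z∼x = contradiction (∼-sym z∼x) (x≁z (e a) t)
    colour-proper _ _ (outer a t) (inner u) z∼y = y-z-colour u a t (∼-sym z∼y) ∘ sym
    colour-proper _ _ (outer a t) (outer b t′) z∼z = z-z-colour a t b t′ z∼z

    module _ {c : Fin n → Fin (suc (suc m))} (agree : ∀ w → Ball w → c w ≡ colour w) where

      x-isBVertex : IsBVertex G c x
      x-isBVertex zero = inj₁ (trans (agree x centre) colour-x)
      x-isBVertex (suc u) = inj₂ (y u , y-adj u , trans (agree (y u) (inner u)) (colour-y u))

      y-isBVertex : ∀ a → IsBVertex G c (y (e a))
      y-isBVertex a j with j ≟ suc (e a)
      ... | yes refl = inj₁ (trans (agree _ (inner (e a))) (colour-y (e a)))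
      y-isBVertex a zero | no _ = inj₂ (x , ∼-sym (y-adj (e a)) , trans (agree x centre) colour-x)
      y-isBVertex a (suc u) | no j≢ = inj₂ (z (e a) t , z-adj (e a) t , (begin
        c (z (e a) t)                            ≡⟨ agree _ (outer a t) ⟩
        colour (z (e a) t)                       ≡⟨ colour-z a t ⟩
        palette (e a) (σ a ⟨$⟩ʳ (σ a ⟨$⟩ˡ i))   ≡⟨ cong (palette (e a)) (inverseʳ (σ a)) ⟩
        suc (punchIn (e a) i)                    ≡⟨ cong suc (punchIn-punchOut ea≢u) ⟩
        suc u                                    ∎))
        where
        ea≢u : e a ≢ u
        ea≢u ea≡u = j≢ (cong suc (sym ea≡u))
        i : Fin m
        i = punchOut ea≢u
        t : Fin m
        t = σ a ⟨$⟩ˡ i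

  bColouring : ∀ {s} → s + s ≤ m → (e : Fin (suc s) → Fin (suc m)) → Injective _≡_ _≡_ e →
    ∃ λ c → Proper G c × IsBVertex G c x × ∀ a → IsBVertex G c (y (e a))
  bColouring 2s≤m e e-injective =
    let σ , compatible = compatibleFamily 2s≤m e
        open BallColouring e e-injective σ compatible
        c , proper , agree = extendColouring (λ v → ≤-reflexive (regular v)) ball? colour colour-proper
    in c , proper , x-isBVertex agree , y-isBVertex agree

lemma1 : (d n : ℕ) → 7 ≤ d → (G : Graph n) → Regular d G → GirthAtLeast 5 G →
    (x : Fin n) →
    Σ (Fin n → Fin (suc d)) λ c →
      Proper G c × IsBVertex G c x ×
      Σ (Fin 4 → Fin n) λ y →
        Injective _≡_ _≡_ y × (∀ i → x ∼[ G ] y i) × (∀ i → IsBVertex G c (y i))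
lemma1 (suc m) n (s≤s 6≤m) G regular girth x =
  let c , proper , x-isBVertex , y-isBVertex = bColouring 6≤m e e-injective
  in c , proper , x-isBVertex , y ∘ e , e-injective ∘ y-injective , y-adj ∘ e , y-isBVertex
  where
  open BVertexColouring G regular girth x
  4≤d : 4 ≤ suc m
  4≤d = s≤s (≤-trans (s≤s (s≤s (s≤s z≤n))) 6≤m)
  e : Fin 4 → Fin (suc m)
  e i = inject≤ i 4≤d
  e-injective : Injective _≡_ _≡_ e
  e-injective = inject≤-injective 4≤d 4≤d _ _
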